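{- Let $a,s,m$ be integers with $a\ge 2$, $s\ge 1$, $m>s$. Let $r_1,r_2$ be integers with $0\le r_1,r_2\le s$ and $r_1\equiv r_2\equiv m \pmod 2$. Let $\mathbf{u}=(u_1,\dots,u_n)$ and $\mathbf{v}=(v_1,\dots,v_k)$ be sequences of positive integers with all entries in $[1,a^s-1]$, first and last entries not in $\{1,a^s-1\}$, and $\langle\mathbf{u}\rangle=a^{(m-r_1)/2}$, $\langle\mathbf{v}\rangle=a^{(m-r_2)/2}$. Let $\mathbf{w}_1$ be one of the sequences obtained from $\mathbf{u}$ with $b=a^{r_1}$, and $\mathbf{w}_2$ one of the sequences obtained from $\mathbf{v}$ with $b=a^{r_2}$, where for a sequence $\mathbf{x}=(x_1,\dots,x_p)$ and $b=a^r$ the sequences obtained from $\mathbf{x}$ are \[ \begin{aligned} &(x_1,\ldots,x_p,b-1,1, x_p-1,x_{p-1},\ldots,x_1),\ (x_1,\ldots,x_{p-1},x_p-1,1,b-1, x_p,\ldots,x_1) &&\text{if } r\neq 0,\\ &(x_1,\ldots,x_{p-1},x_p+1,x_p-1,x_{p-1},\ldots,x_1),\ (x_1,\ldots,x_{p-1},x_p-1,x_p+1,x_{p-1},\ldots,x_1) &&\text{if } r=0. \end{aligned} \] (so that $\langle\mathbf{w}_1\rangle=\langle\mathbf{w}_2\rangle=a^m$). If $\mathbf{u}\neq\mathbf{v}$, then $\mathbf{w}_1\neq\mathbf{w}_2$.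
   Context: For a finite sequence of positive integers $(a_1,\dots,a_n)$, its continuant $\langle a_1,\dots,a_n\rangle$ is the denominator of the continued fraction $[0;a_1,\dots,a_n]$; equivalently $\langle\,\rangle=1$, $\langle a_1\rangle=a_1$, and $\langle a_1,\dots,a_n\rangle=a_n\langle a_1,\dots,a_{n-1}\rangle+\langle a_1,\dots,a_{n-2}\rangle$. -}

module Defs where

open import Data.Nat using (ℕ; zero; suc; _+_; _*_; _∸_; _^_; _≤_)
open import Data.List using (List; []; _∷_; _++_; _∷ʳ_; reverse; foldl; head; last)
open import Data.List.Relation.Unary.All using (All)
open import Data.Maybe using (just)
open import Data.Product using (_×_; proj₂; _,_)
open import Data.Sum using (_⊎_)
open import Relation.Binary.PropositionalEquality using (_≡_; _≢_)

-- Continuant ⟨a₁,…,aₙ⟩ via the recurrence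
--   ⟨⟩ = 1, ⟨a₁⟩ = a₁, ⟨a₁,…,aₙ⟩ = aₙ⟨a₁,…,aₙ₋₁⟩ + ⟨a₁,…,aₙ₋₂⟩,
-- computed left to right on the pair (⟨…,aₙ₋₁⟩ , ⟨…,aₙ⟩),
-- starting from (K₋₁ , K₀) = (0 , 1)  (so that ⟨a₁⟩ = a₁·1 + 0).
contStep : ℕ × ℕ → ℕ → ℕ × ℕ
contStep (p , q) x = (q , x * q + p)

continuant : List ℕ → ℕ
continuant xs = proj₂ (foldl contStep (0 , 1) xs)

record Admissible (a s : ℕ) (xs : List ℕ) : Set where
  field
    nonempty  : xs ≢ []
    inRange   : All (λ x → 1 ≤ x × x ≤ a ^ s ∸ 1) xs
    endpoints : ∀ x → (head xs ≡ just x ⊎ last xs ≡ just x) →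
                x ≢ 1 × x ≢ a ^ s ∸ 1

-- Obtained a r x w : w is one of the sequences obtained from x with b = a^r.
-- The sequence x = (x₁,…,x_{p-1},x_p) is written ys ∷ʳ z with ys = (x₁,…,x_{p-1}), z = x_p.
data Obtained (a r : ℕ) : List ℕ → List ℕ → Set where
  nz₁ : ∀ ys z → r ≢ 0 →
        Obtained a r (ys ∷ʳ z) ((ys ∷ʳ z) ++ ((a ^ r ∸ 1) ∷ 1 ∷ (z ∸ 1) ∷ reverse ys))
  nz₂ : ∀ ys z → r ≢ 0 →
        Obtained a r (ys ∷ʳ z) (ys ++ ((z ∸ 1) ∷ 1 ∷ (a ^ r ∸ 1) ∷ reverse (ys ∷ʳ z)))
  z₁ : ∀ ys z → r ≡ 0 →
       Obtained a r (ys ∷ʳ z) (ys ++ ((z + 1) ∷ (z ∸ 1) ∷ reverse ys))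
  z₂ : ∀ ys z → r ≡ 0 →
       Obtained a r (ys ∷ʳ z) (ys ++ ((z ∸ 1) ∷ (z + 1) ∷ reverse ys))

module Submission where

-- Each of the four constructions turns x = (x₁,…,x_{p-1}, z) into a "frame"
--   w = ys ++ M ++ reverse ys,   ys = (x₁,…,x_{p-1}),
-- around a middle block M which is either (z, b-1, 1, z-1), (z-1, 1, b-1, z)
-- (four entries with distinct ends, since z ≥ 1) or (z+1, z-1), (z-1, z+1)
-- (two entries).  In every case z is read off the ends of M: it is their
-- maximum for a four-entry block and their maximum minus one for a two-entry
-- block.  So it suffices to see that a frame determines its outer part and its
-- block: the outer parts of two equal frames are prefixes of one another, and
-- an extra outer entry c would force the longer block to be (c, …, …, c) around
-- the shorter one, contradicting the distinct ends.  Hence u ≠ v gives w₁ ≠ w₂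
-- using only that the last entries of u and v are positive.

open import Defs
open import Data.Nat using (ℕ; suc; _≤_; _<_; _+_; _∸_; _^_; _/_; _%_; _⊔_)
open import Data.Nat.Properties
  using (suc-injective; +-comm; +-assoc; m+1+n≢0; m∸n≤m; m≤m+n; m+n∸n≡m; ≤-trans; ⊔-comm; m≥n⇒m⊔n≡m)
open import Data.List using (List; []; _∷_; _++_; _∷ʳ_; reverse; length)
open import Data.List.Properties
  using (∷-injective; ++-assoc; ++-cancelˡ; ++-cancelʳ; ++-identityʳ; reverse-++; length-++; length-reverse)
open import Data.List.Relation.Unary.All as All using (All)
open import Data.List.Relation.Unary.All.Properties using (∷ʳ⁻)
open import Data.Product using (_×_; _,_; proj₁; proj₂; ∃)
open import Data.Sum using (_⊎_; inj₁; inj₂)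
open import Data.Empty using (⊥-elim)
open import Relation.Binary.PropositionalEquality
  using (_≡_; _≢_; refl; sym; trans; cong; ≢-sym; module ≡-Reasoning)

private
  variable
    A : Set
    a r r₁ r₂ : ℕ
    m m' x x₁ x₂ w : List ℕ

prefix-dichotomy : (ys ys' X Y : List A) → ys ++ X ≡ ys' ++ Y →
                   (∃ λ d → ys' ≡ ys ++ d) ⊎ (∃ λ d → ys ≡ ys' ++ d)
prefix-dichotomy []       ys'       _ _ _  = inj₁ (ys' , refl)
prefix-dichotomy (y ∷ ys) []        _ _ _  = inj₂ (y ∷ ys , refl)
prefix-dichotomy (y ∷ ys) (y' ∷ ys') X Y eq with refl , eq' ← ∷-injective eq
  with prefix-dichotomy ys ys' X Y eq'
... | inj₁ (d , refl) = inj₁ (d , refl)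
... | inj₂ (d , refl) = inj₂ (d , refl)

frame-nest : (ys d m m' : List A) →
             ys ++ (m ++ reverse ys) ≡ (ys ++ d) ++ (m' ++ reverse (ys ++ d)) →
             m ≡ d ++ (m' ++ reverse d)
frame-nest ys d m m' eq =
  ++-cancelʳ (reverse ys) m (d ++ (m' ++ reverse d)) (++-cancelˡ ys _ _ regrouped)
  where
  open ≡-Reasoning
  regrouped : ys ++ (m ++ reverse ys) ≡ ys ++ ((d ++ (m' ++ reverse d)) ++ reverse ys)
  regrouped = begin
    ys ++ (m ++ reverse ys)                          ≡⟨ eq ⟩
    (ys ++ d) ++ (m' ++ reverse (ys ++ d))           ≡⟨ ++-assoc ys d _ ⟩
    ys ++ (d ++ (m' ++ reverse (ys ++ d)))           ≡⟨ cong (λ t → ys ++ (d ++ (m' ++ t))) (reverse-++ ys d) ⟩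
    ys ++ (d ++ (m' ++ (reverse d ++ reverse ys)))   ≡⟨ cong (λ t → ys ++ (d ++ t)) (sym (++-assoc m' (reverse d) _)) ⟩
    ys ++ (d ++ ((m' ++ reverse d) ++ reverse ys))   ≡⟨ cong (ys ++_) (sym (++-assoc d (m' ++ reverse d) _)) ⟩
    ys ++ ((d ++ (m' ++ reverse d)) ++ reverse ys)   ∎

wrap-length : (d m : List A) → length (d ++ (m ++ reverse d)) ≡ length m + (length d + length d)
wrap-length d m = begin
  length (d ++ (m ++ reverse d))               ≡⟨ length-++ d ⟩
  length d + length (m ++ reverse d)           ≡⟨ cong (length d +_) (length-++ m) ⟩
  length d + (length m + length (reverse d))   ≡⟨ cong (λ k → length d + (length m + k)) (length-reverse d) ⟩
  length d + (length m + length d)             ≡⟨ +-comm (length d) _ ⟩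
  (length m + length d) + length d             ≡⟨ +-assoc (length m) _ _ ⟩
  length m + (length d + length d)             ∎
  where open ≡-Reasoning

data Block : List ℕ → Set where
  long  : ∀ {p q} b c → p ≢ q → Block (p ∷ b ∷ c ∷ q ∷ [])
  short : ∀ p q → Block (p ∷ q ∷ [])

-- The last entry of the source sequence, read off the ends of its block.
recover : Block m → ℕ
recover (long {p} {q} _ _ _) = p ⊔ q
recover (short p q)          = (p ⊔ q) ∸ 1

recover-unique : (bl bl' : Block m) → recover bl ≡ recover bl'
recover-unique (long _ _ _) (long _ _ _) = refl
recover-unique (short _ _)  (short _ _)  = refl

-- A block is never another block wrapped in a nonempty d: wrapping in one entry c
-- would give a four-entry block (c, …, …, c), and wrapping in more is too long.
blocks-rigid : Block m → Block m' → (d : List ℕ) → m ≡ d ++ (m' ++ reverse d) →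
               d ≡ [] × m ≡ m'
blocks-rigid _ _ [] eq = refl , trans eq (++-identityʳ _)
blocks-rigid (long _ _ ends≢) (short _ _) (_ ∷ []) refl = ⊥-elim (ends≢ refl)
blocks-rigid (long _ _ _) (long _ _ _) (_ ∷ []) ()
blocks-rigid (short _ _)  (long _ _ _) (_ ∷ []) ()
blocks-rigid (short _ _)  (short _ _)  (_ ∷ []) ()
blocks-rigid bl bl' d@(_ ∷ _ ∷ _) eq = ⊥-elim (too-long bl bl' (trans (cong length eq) (wrap-length d _)))
  where
  -- a block has 2 or 4 entries, so it cannot have 4 more entries than another block
  too-long : ∀ {k} → Block m → Block m' → length m ≢ length m' + (suc (suc k) + suc (suc k))
  too-long {k = k} (long _ _ _) (short _ _) len =
    m+1+n≢0 k (sym (suc-injective (suc-injective (suc-injective (suc-injective len)))))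
  too-long (long _ _ _) (long _ _ _) ()
  too-long (short _ _)  (long _ _ _) ()
  too-long (short _ _)  (short _ _)  ()

frames-nested : ∀ {ys ys' d} → Block m → Block m' → ys' ≡ ys ++ d →
                ys ++ (m ++ reverse ys) ≡ ys' ++ (m' ++ reverse ys') → ys ≡ ys' × m ≡ m'
frames-nested {ys = ys} {d = d} bl bl' refl eq with blocks-rigid bl bl' d (frame-nest ys d _ _ eq)
... | refl , m≡m' = sym (++-identityʳ ys) , m≡m'

frames-equal : ∀ {ys ys'} → Block m → Block m' →
               ys ++ (m ++ reverse ys) ≡ ys' ++ (m' ++ reverse ys') → ys ≡ ys' × m ≡ m'
frames-equal {ys = ys} {ys'} bl bl' eq with prefix-dichotomy ys ys' _ _ eq
... | inj₁ (d , ys'≡ys++d) = frames-nested bl bl' ys'≡ys++d eq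
... | inj₂ (d , ys≡ys'++d) with frames-nested {ys = ys'} {ys} bl' bl ys≡ys'++d (sym eq)
...   | refl , refl = refl , refl

record Framing (x w : List ℕ) : Set where
  constructor framing
  field
    {middle} : List ℕ
    outer    : List ℕ
    block    : Block middle
    source   : x ≡ outer ∷ʳ recover block
    target   : w ≡ outer ++ (middle ++ reverse outer)

framings-agree : Framing x₁ w → Framing x₂ w → x₁ ≡ x₂
framings-agree (framing ys bl refl refl) (framing ys' bl' refl eq) with frames-equal {ys = ys} {ys'} bl bl' eq
... | refl , refl = cong (ys ∷ʳ_) (recover-unique bl bl')

pred-≢ : ∀ {z} → 1 ≤ z → z ≢ z ∸ 1
pred-≢ {suc _} _ ()

max-pred : ∀ z → z ⊔ (z ∸ 1) ≡ z
max-pred z = m≥n⇒m⊔n≡m (m∸n≤m z 1)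

max-succ-pred : ∀ z → ((z + 1) ⊔ (z ∸ 1)) ∸ 1 ≡ z
max-succ-pred z = trans (cong (_∸ 1) (m≥n⇒m⊔n≡m (≤-trans (m∸n≤m z 1) (m≤m+n z 1)))) (m+n∸n≡m z 1)

decompose : Obtained a r x w → All (1 ≤_) x → Framing x w
decompose (nz₁ ys z _) pos =
  framing ys (long _ 1 (pred-≢ (proj₂ (∷ʳ⁻ pos))))
    (cong (ys ∷ʳ_) (sym (max-pred z)))
    (++-assoc ys (z ∷ []) _)
decompose (nz₂ ys z _) pos =
  framing ys (long 1 _ (≢-sym (pred-≢ (proj₂ (∷ʳ⁻ pos)))))
    (cong (ys ∷ʳ_) (sym (trans (⊔-comm (z ∸ 1) z) (max-pred z))))
    (cong (λ t → ys ++ ((z ∸ 1) ∷ 1 ∷ _ ∷ t)) (reverse-++ ys (z ∷ [])))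
decompose (z₁ ys z _) _ =
  framing ys (short (z + 1) (z ∸ 1)) (cong (ys ∷ʳ_) (sym (max-succ-pred z))) refl
decompose (z₂ ys z _) _ =
  framing ys (short (z ∸ 1) (z + 1))
    (cong (ys ∷ʳ_) (sym (trans (cong (_∸ 1) (⊔-comm (z ∸ 1) (z + 1))) (max-succ-pred z)))) refl

obtained-injective : Obtained a r₁ x₁ w → Obtained a r₂ x₂ w →
                     All (1 ≤_) x₁ → All (1 ≤_) x₂ → x₁ ≡ x₂
obtained-injective o₁ o₂ pos₁ pos₂ = framings-agree (decompose o₁ pos₁) (decompose o₂ pos₂)

admissible-positive : ∀ {s} → Admissible a s x → All (1 ≤_) x
admissible-positive ad = All.map proj₁ (Admissible.inRange ad)

lemma3 : (a s m r₁ r₂ : ℕ) → 2 ≤ a → 1 ≤ s → s < m →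
         r₁ ≤ s → r₂ ≤ s → r₁ % 2 ≡ m % 2 → r₂ % 2 ≡ m % 2 →
         (u v w₁ w₂ : List ℕ) →
         Admissible a s u → Admissible a s v →
         continuant u ≡ a ^ ((m ∸ r₁) / 2) → continuant v ≡ a ^ ((m ∸ r₂) / 2) →
         Obtained a r₁ u w₁ → Obtained a r₂ v w₂ →
         u ≢ v → w₁ ≢ w₂
lemma3 _ _ _ _ _ _ _ _ _ _ _ _ _ _ _ _ adu adv _ _ o₁ o₂ u≢v refl =
  u≢v (obtained-injective o₁ o₂ (admissible-positive adu) (admissible-positive adv))
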